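{- Let $G,H$ be $N$-player partizan games. Suppose that for every Left option $G^L$ of $G$ there is a Left option $H^L$ of $H$ with $G^L\le_L H^L$, and that for every $1\le i\le N-1$ and every $C_i$-option $H^{C_i}$ of $H$ there is a $C_i$-option $G^{C_i}$ of $G$ with $G^{C_i}\le_L H^{C_i}$. Then $G\le_L H$.
   Context: An $N$-player partizan game ($N\ge2$) is an ordered $N$-tuple $(\mathscr G^{C_0},\dots,\mathscr G^{C_{N-1}})$ of finite sets of partizan games (no infinite runs); players Left $=C_0$, $C_1,\dots,C_{N-2}$, Right $=C_{N-1}$ move cyclically (Left after Right), $\mathscr G^{C_i}$ being the options for $C_i$. Under normal play, a player with no option on their turn is the unique loser and all others win. The disjunctive sum $G+H$ has $C_i$-options $G^{C_i}+H$ and $G+H^{C_i}$. "Left has a winning strategy in $G$ moving $i$th" ($1\le i\le N$) means that when play starts with the player for whom Left is $i$th to move, Left can guarantee not being the loser. $G\le_L H$ means: for every game $X$ and every $1\le i\le N$, if Left has a winning strategy in $G+X$ moving $i$th then Left has one in $H+X$ moving $i$th. -}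

module Defs where

open import Data.Nat using (ℕ; zero; suc; _+_; _<?_)
open import Data.Fin using (Fin; zero; suc; toℕ; fromℕ<; splitAt; opposite; inject₁)
open import Data.Sum using ([_,_]′)
open import Data.Product using (Σ)
open import Relation.Nullary using (yes; no)

-- Players are Fin N; Left = C₀ = zero, Right = C_{N-1}.  Inductive, so no infinite runs.
data Game (N : ℕ) : Set where
  mk : (count : Fin N → ℕ) → ((i : Fin N) → Fin (count i) → Game N) → Game N

count : ∀ {N} → Game N → Fin N → ℕ
count (mk c _) = c

opt : ∀ {N} (G : Game N) (i : Fin N) → Fin (count G i) → Game N
opt (mk _ o) = o

-- Disjunctive sum: C_i options are G^{C_i}+H and G+H^{C_i}.
_⊕_ : ∀ {N} → Game N → Game N → Game N
mk c o ⊕ mk d p =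
  mk (λ i → c i + d i)
     (λ i x → [ (λ a → o i a ⊕ mk d p) , (λ b → mk c o ⊕ p i b) ]′ (splitAt (c i) x))

next : ∀ {m} → Fin (suc m) → Fin (suc m)
next {m} i with suc (toℕ i) <? suc m
... | yes p = fromℕ< p
... | no _  = zero

-- LeftWins s G : Left (player zero) can guarantee not to be the loser
-- when player s is to move in G.
LeftWins : ∀ {m} → Fin (suc m) → Game (suc m) → Set
LeftWins zero    (mk c o) = Σ (Fin (c zero)) λ a → LeftWins (next zero) (o zero a)
LeftWins (suc j) (mk c o) = (a : Fin (c (suc j))) → LeftWins (next (suc j)) (o (suc j) a)

-- The player who starts so that Left is the (k+1)-th to move (k = 0,…,N-1):
-- start k = -k mod N.
start : ∀ {m} → Fin (suc m) → Fin (suc m)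
start zero    = zero
start (suc k) = opposite (inject₁ k)

LeftWinsMoving : ∀ {m} → Fin (suc m) → Game (suc m) → Set
LeftWinsMoving k G = LeftWins (start k) G

_≤L_ : ∀ {m} → Game (suc m) → Game (suc m) → Set
_≤L_ {m} G H = (X : Game (suc m)) (k : Fin (suc m)) →
  LeftWinsMoving k (G ⊕ X) → LeftWinsMoving k (H ⊕ X)

module Submission where

-- Left's winning strategy in G ⊕ X is transferred to H ⊕ X move
-- by move, by induction on X, for every player s to move:
--   * Left to move in G ⊕ X: if Left's winning move is G^L ⊕ X, she answers
--     with H^L ⊕ X where G^L ≤L H^L (hypothesis on Left options); if it is
--     G ⊕ X^L, she plays H ⊕ X^L and wins by induction.
--   * C_i to move in H ⊕ X (i ≠ Left): a move to H^{C_i} ⊕ X is matched by the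
--     move G^{C_i} ⊕ X with G^{C_i} ≤L H^{C_i}; a move to H ⊕ X^{C_i} is
--     matched by G ⊕ X^{C_i}, again by induction.

open import Defs
open import Data.Nat using (ℕ; suc; _∸_)
open import Data.Nat.Properties using (m∸[m∸n]≡n)
open import Data.Fin using (Fin; zero; suc; toℕ; splitAt; _↑ˡ_; _↑ʳ_; opposite; inject₁)
open import Data.Fin.Properties using (splitAt-↑ˡ; splitAt-↑ʳ; opposite-prop; toℕ-inject₁; toℕ-injective; toℕ<n)
open import Data.Sum using (_⊎_; inj₁; inj₂; [_,_]′)
open import Data.Product using (Σ; _,_)
open import Relation.Binary.PropositionalEquality using (_≡_; refl; sym; cong; subst; module ≡-Reasoning)

⊕-moveˡ : ∀ {N} (G X : Game N) (i : Fin N) (a : Fin (count G i)) →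
  Σ (Fin (count (G ⊕ X) i)) λ x → opt (G ⊕ X) i x ≡ opt G i a ⊕ X
⊕-moveˡ (mk c o) (mk d p) i a =
  a ↑ˡ d i , cong [ (λ a′ → o i a′ ⊕ mk d p) , (λ b → mk c o ⊕ p i b) ]′ (splitAt-↑ˡ (c i) a (d i))

⊕-moveʳ : ∀ {N} (G X : Game N) (i : Fin N) (b : Fin (count X i)) →
  Σ (Fin (count (G ⊕ X) i)) λ x → opt (G ⊕ X) i x ≡ G ⊕ opt X i b
⊕-moveʳ (mk c o) (mk d p) i b =
  c i ↑ʳ b , cong [ (λ a → o i a ⊕ mk d p) , (λ b′ → mk c o ⊕ p i b′) ]′ (splitAt-↑ʳ (c i) (d i) b)

⊕-options : ∀ {N} (G X : Game N) (i : Fin N) (x : Fin (count (G ⊕ X) i)) →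
  (Σ (Fin (count G i)) λ a → opt (G ⊕ X) i x ≡ opt G i a ⊕ X) ⊎
  (Σ (Fin (count X i)) λ b → opt (G ⊕ X) i x ≡ G ⊕ opt X i b)
⊕-options (mk c o) (mk d p) i x with splitAt (c i) x
... | inj₁ a = inj₁ (a , refl)
... | inj₂ b = inj₂ (b , refl)

leftWins-left : ∀ {m} (G : Game (suc m)) →
  LeftWins zero G → Σ (Fin (count G zero)) λ a → LeftWins (next zero) (opt G zero a)
leftWins-left (mk c o) w = w

leftWins-left⁻ : ∀ {m} (G : Game (suc m)) →
  (Σ (Fin (count G zero)) λ a → LeftWins (next zero) (opt G zero a)) → LeftWins zero G
leftWins-left⁻ (mk c o) w = w

leftWins-opponent : ∀ {m} (j : Fin m) (G : Game (suc m)) →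
  LeftWins (suc j) G → (a : Fin (count G (suc j))) → LeftWins (next (suc j)) (opt G (suc j) a)
leftWins-opponent j (mk c o) w = w

leftWins-opponent⁻ : ∀ {m} (j : Fin m) (G : Game (suc m)) →
  ((a : Fin (count G (suc j))) → LeftWins (next (suc j)) (opt G (suc j) a)) → LeftWins (suc j) G
leftWins-opponent⁻ j (mk c o) w = w

start-surjective : ∀ {m} (s : Fin (suc m)) → Σ (Fin (suc m)) λ k → start k ≡ s
start-surjective zero = zero , refl
start-surjective {m} (suc j) = suc (opposite j) , toℕ-injective toℕ-start
  where
  open ≡-Reasoning
  toℕ-start : toℕ (opposite (inject₁ (opposite j))) ≡ suc (toℕ j)
  toℕ-start = begin
    toℕ (opposite (inject₁ (opposite j))) ≡⟨ opposite-prop (inject₁ (opposite j)) ⟩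
    m ∸ toℕ (inject₁ (opposite j))        ≡⟨ cong (m ∸_) (toℕ-inject₁ (opposite j)) ⟩
    m ∸ toℕ (opposite j)                  ≡⟨ cong (m ∸_) (opposite-prop j) ⟩
    m ∸ (m ∸ suc (toℕ j))                 ≡⟨ m∸[m∸n]≡n (toℕ<n j) ⟩
    suc (toℕ j)                           ∎

≤L-transfer : ∀ {m} {G H : Game (suc m)} → G ≤L H →
  (X : Game (suc m)) (s : Fin (suc m)) → LeftWins s (G ⊕ X) → LeftWins s (H ⊕ X)
≤L-transfer G≤H X s with start-surjective s
... | k , refl = G≤H X k

record OptionsDominated {m} (G H : Game (suc m)) : Set where
  field
    leftAnswer     : (a : Fin (count G zero)) →
                     Σ (Fin (count H zero)) λ b → opt G zero a ≤L opt H zero b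
    opponentAnswer : (j : Fin m) (b : Fin (count H (suc j))) →
                     Σ (Fin (count G (suc j))) λ a → opt G (suc j) a ≤L opt H (suc j) b

dominated-transfer : ∀ {m} {G H : Game (suc m)} → OptionsDominated G H →
  (X : Game (suc m)) (s : Fin (suc m)) → LeftWins s (G ⊕ X) → LeftWins s (H ⊕ X)
dominated-transfer {m} {G} {H} dom X@(mk d p) zero w =
  leftWins-left⁻ (H ⊕ X) (answer (leftWins-left (G ⊕ X) w))
  where
  s′ : Fin (suc m)
  s′ = next zero

  answer : (Σ (Fin (count (G ⊕ X) zero)) λ x → LeftWins s′ (opt (G ⊕ X) zero x)) →
           Σ (Fin (count (H ⊕ X) zero)) λ y → LeftWins s′ (opt (H ⊕ X) zero y)
  answer (x , winAfter) with ⊕-options G X zero x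
  ... | inj₁ (a , G⊕X→Ga) with OptionsDominated.leftAnswer dom a
  ...   | b , Ga≤Hb with ⊕-moveˡ H X zero b
  ...     | y , H⊕X→Hb = y , subst (LeftWins s′) (sym H⊕X→Hb)
            (≤L-transfer Ga≤Hb X s′ (subst (LeftWins s′) G⊕X→Ga winAfter))
  answer (x , winAfter) | inj₂ (b , G⊕X→Xb) with ⊕-moveʳ H X zero b
  ...     | y , H⊕X→Xb = y , subst (LeftWins s′) (sym H⊕X→Xb)
            (dominated-transfer dom (p zero b) s′ (subst (LeftWins s′) G⊕X→Xb winAfter))
dominated-transfer {m} {G} {H} dom X@(mk d p) (suc j) w =
  leftWins-opponent⁻ j (H ⊕ X) answer
  where
  s′ : Fin (suc m)
  s′ = next (suc j)

  winsAfter : (x : Fin (count (G ⊕ X) (suc j))) → LeftWins s′ (opt (G ⊕ X) (suc j) x)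
  winsAfter = leftWins-opponent j (G ⊕ X) w

  answer : (y : Fin (count (H ⊕ X) (suc j))) → LeftWins s′ (opt (H ⊕ X) (suc j) y)
  answer y with ⊕-options H X (suc j) y
  ... | inj₁ (b , H⊕X→Hb) with OptionsDominated.opponentAnswer dom j b
  ...   | a , Ga≤Hb with ⊕-moveˡ G X (suc j) a
  ...     | x , G⊕X→Ga = subst (LeftWins s′) (sym H⊕X→Hb)
            (≤L-transfer Ga≤Hb X s′ (subst (LeftWins s′) G⊕X→Ga (winsAfter x)))
  answer y | inj₂ (b , H⊕X→Xb) with ⊕-moveʳ G X (suc j) b
  ...     | x , G⊕X→Xb = subst (LeftWins s′) (sym H⊕X→Xb)
            (dominated-transfer dom (p (suc j) b) s′ (subst (LeftWins s′) G⊕X→Xb (winsAfter x)))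

mainTheorem15 : (n : ℕ) (G H : Game (suc (suc n))) →
    ((a : Fin (count G zero)) → Σ (Fin (count H zero)) λ b → opt G zero a ≤L opt H zero b) →
    ((i : Fin (suc n)) (b : Fin (count H (suc i))) →
      Σ (Fin (count G (suc i))) λ a → opt G (suc i) a ≤L opt H (suc i) b) →
    G ≤L H
mainTheorem15 n G H leftDominated opponentDominated X k =
  dominated-transfer dom X (start k)
  where
  dom : OptionsDominated G H
  dom = record { leftAnswer = leftDominated ; opponentAnswer = opponentDominated }
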